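{- Let $n$ be a Kalita-Saikia number such that $p^4\mid n$ for every prime $p$ dividing $n$. Then $$\frac{\sigma(\sigma(n))}{n}\le\prod_{p\mid n,\ p \text{ prime}}\left(\frac{p}{p-1}+\frac{1}{p^4}\right).$$
   Context: $\sigma(m)$ denotes the sum of the positive divisors of $m$. For a prime $p$ and integer $a\ge1$, $p^a\| n$ means $p^a\mid n$ and $p^{a+1}\nmid n$. A positive integer $n$ is a Kalita-Saikia number if $\sigma(p^a)$ is prime whenever $p$ is a prime and $p^a\| n$. -}

module Defs where

open import Data.Nat using (ℕ; zero; suc; _∸_; _^_; _<_; _≤_)
open import Data.Nat.Divisibility using (_∣_; _∣?_)
open import Data.Nat.Primality using (Prime; prime?)
open import Data.Nat.ListAction using (sum)
open import Data.List using (List; filter; upTo; map; foldr)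
open import Data.Integer using (+_)
open import Data.Rational using (ℚ; 1ℚ; 0ℚ) renaming (_/_ to _/ℚ_; _*_ to _*ℚ_; _+_ to _+ℚ_)
open import Relation.Nullary using (¬_)

divisors : ℕ → List ℕ
divisors m = filter (_∣? m) (map suc (upTo m))

σ : ℕ → ℕ
σ m = sum (divisors m)

_^_∥_ : ℕ → ℕ → ℕ → Set
p ^ a ∥ n = (p ^ a ∣ n) × ¬ (p ^ suc a ∣ n)
  where open import Data.Product using (_×_)

KalitaSaikia : ℕ → Set
KalitaSaikia n = (0 < n) × (∀ p a → Prime p → 1 ≤ a → p ^ a ∥ n → Prime (σ (p ^ a)))
  where open import Data.Product using (_×_)

primeDivisors : ℕ → List ℕ
primeDivisors n = filter prime? (divisors n)

-- the rational a / b (used only with b ≥ 1; returns 0 when b = 0)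
frac : ℕ → ℕ → ℚ
frac a zero = 0ℚ
frac a (suc b) = (+ a) /ℚ (suc b)

prodℚ : List ℚ → ℚ
prodℚ = foldr _*ℚ_ 1ℚ

-- the factor p/(p-1) + 1/p^4 (denominators nonzero for primes p)
factor : ℕ → ℚ
factor p = frac p (p ∸ 1) +ℚ frac 1 (p ^ 4)

{-# OPTIONS --safe #-}
-- Write n = p^a m with p prime and p ∤ m. Since σ is multiplicative on coprime arguments and
-- submultiplicative in general, σ(σ(n)) ≤ σ(q) σ(σ(m)) for q = σ(p^a), which is prime by the
-- Kalita–Saikia condition, so σ(q) = q + 1. The geometric series gives (p − 1) q < p^(a+1), hence
-- (q + 1) / p^a ≤ p / (p − 1) + 1 / p^a ≤ p / (p − 1) + 1 / p^4 as a ≥ 4, and strong induction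
-- on n multiplies these local bounds over the prime divisors of n.
module Submission where

open import Defs

module Arithmetic where
  open import Data.Nat
  open import Data.Nat.Properties
  open import Data.Nat.Divisibility
  open import Data.Nat.Coprimality using (Coprime; coprime-divisor; coprime-/gcd) renaming (sym to coprime-sym)
  open import Data.Nat.DivMod using (m*[n/m]≡n)
  open import Data.Nat.GCD using (gcd; gcd[m,n]∣m; gcd[m,n]∣n; gcd[m,n]≢0)
  open import Data.Nat.Primality using (Prime; prime?; prime⇒irreducible; prime⇒nonZero; prime⇒nonTrivial; ¬prime[1]; euclidsLemma)
  open import Data.Nat.ListAction using (sum; product)
  open import Data.Nat.Induction using (<-rec)
  open import Data.Nat.Primality.Factorisation using (factorise)
  open import Data.Nat.ListAction.Properties using (sum-++; sum-↭)
  open import Data.List using ([]; _∷_; _++_; upTo; map; applyDownFrom; cartesianProductWith)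
  open import Data.List.Membership.Propositional using (_∈_)
  open import Data.List.Membership.Propositional.Properties
  open import Data.List.Membership.Propositional.Properties.WithK using (unique∧set⇒bag)
  open import Data.List.Relation.Binary.BagAndSetEquality using (∼bag⇒↭)
  open import Data.List.Relation.Binary.Permutation.Propositional using (_↭_)
  open import Data.List.Relation.Binary.Disjoint.Propositional using (Disjoint)
  open import Data.List.Relation.Binary.Permutation.Propositional.Properties using (∈-resp-↭; shift)
  open import Data.List.Relation.Binary.Subset.Propositional using (_⊆_)
  open import Data.List.Relation.Unary.All as All using (_∷_)
  import Data.List.Relation.Unary.All.Properties as All
  open import Data.List.Relation.Unary.Any using (here; there)
  open import Data.List.Relation.Unary.Unique.Propositional using (Unique; []; _∷_)
  import Data.List.Relation.Unary.Unique.Propositional.Properties as Unique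
  open import Data.Product using (∃-syntax; _×_; _,_; proj₁; proj₂)
  open import Data.Sum using (inj₁; inj₂)
  open import Data.Empty using (⊥-elim)
  open import Relation.Nullary using (¬_; yes; no; contradiction)
  open import Relation.Binary.PropositionalEquality
  open import Function using (_∘_; mk⇔)

  sum-mono-⊆ : ∀ {xs ys} → Unique xs → xs ⊆ ys → sum xs ≤ sum ys
  sum-mono-⊆ {[]} _ _ = z≤n
  sum-mono-⊆ {x ∷ xs} (x∉xs ∷ xs!) xs⊆ys with ys₁ , ys₂ , refl ← ∈-∃++ (xs⊆ys (here refl)) = begin
    x + sum xs              ≤⟨ +-monoʳ-≤ x (sum-mono-⊆ xs! xs⊆ys₁++ys₂) ⟩
    x + sum (ys₁ ++ ys₂)    ≡⟨ sum-↭ (shift x ys₁ ys₂) ⟨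
    sum (ys₁ ++ x ∷ ys₂)    ∎
    where
    open ≤-Reasoning
    xs⊆ys₁++ys₂ : xs ⊆ ys₁ ++ ys₂
    xs⊆ys₁++ys₂ y∈xs with ∈-resp-↭ (shift x ys₁ ys₂) (xs⊆ys (there y∈xs))
    ... | here refl = ⊥-elim (All.lookup x∉xs y∈xs refl)
    ... | there y∈ys₁++ys₂ = y∈ys₁++ys₂

  sum-map-*ˡ : ∀ x ys → sum (map (x *_) ys) ≡ x * sum ys
  sum-map-*ˡ x [] = sym (*-zeroʳ x)
  sum-map-*ˡ x (y ∷ ys) = trans (cong (x * y +_) (sum-map-*ˡ x ys)) (sym (*-distribˡ-+ x y (sum ys)))

  sum-cartesianProductWith-* : ∀ xs ys → sum (cartesianProductWith _*_ xs ys) ≡ sum xs * sum ys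
  sum-cartesianProductWith-* [] ys = refl
  sum-cartesianProductWith-* (x ∷ xs) ys = begin
    sum (map (x *_) ys ++ cartesianProductWith _*_ xs ys)  ≡⟨ sum-++ (map (x *_) ys) _ ⟩
    sum (map (x *_) ys) + sum (cartesianProductWith _*_ xs ys)
                                                           ≡⟨ cong₂ _+_ (sum-map-*ˡ x ys) (sum-cartesianProductWith-* xs ys) ⟩
    x * sum ys + sum xs * sum ys                           ≡⟨ *-distribʳ-+ (sum ys) x (sum xs) ⟨
    (x + sum xs) * sum ys                                  ∎
    where open ≡-Reasoning

  map⁺-injectiveOn : ∀ {A B : Set} {f : A → B} {xs} →
                     (∀ {x y} → x ∈ xs → y ∈ xs → f x ≡ f y → x ≡ y) → Unique xs → Unique (map f xs)
  map⁺-injectiveOn inj [] = []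
  map⁺-injectiveOn {f = f} inj (x∉xs ∷ xs!) =
    All.map⁺ (All.tabulate λ y∈xs fx≡fy → All.lookup x∉xs y∈xs (inj (here refl) (there y∈xs) fx≡fy))
    ∷ map⁺-injectiveOn (λ x∈ y∈ → inj (there x∈) (there y∈)) xs!

  cartesianProductWith⁺-injectiveOn : ∀ {A B C : Set} (f : A → B → C) {xs ys} →
    (∀ {w x y z} → w ∈ xs → x ∈ xs → y ∈ ys → z ∈ ys → f w y ≡ f x z → w ≡ x × y ≡ z) →
    Unique xs → Unique ys → Unique (cartesianProductWith f xs ys)
  cartesianProductWith⁺-injectiveOn f inj [] ys! = []
  cartesianProductWith⁺-injectiveOn f {x ∷ xs} {ys} inj (x∉xs ∷ xs!) ys! = Unique.++⁺
    (map⁺-injectiveOn (λ y∈ z∈ → proj₂ ∘ inj (here refl) (here refl) y∈ z∈) ys!)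
    (cartesianProductWith⁺-injectiveOn f (λ w∈ x∈ → inj (there w∈) (there x∈)) xs! ys!)
    row#rest
    where
    row#rest : Disjoint (map (f x) ys) (cartesianProductWith f xs ys)
    row#rest (v∈row , v∈rest) with y , y∈ , refl ← ∈-map⁻ (f x) v∈row
                              with w , z , w∈ , z∈ , fxy≡fwz ← ∈-cartesianProductWith⁻ f xs ys v∈rest
      = All.lookup x∉xs w∈ (proj₁ (inj (here refl) (there w∈) y∈ z∈ fxy≡fwz))

  divisors-unique : ∀ m → Unique (divisors m)
  divisors-unique m = Unique.filter⁺ (_∣? m) (Unique.map⁺ suc-injective (Unique.upTo⁺ m))

  ∈-divisors⁻ : ∀ m {d} → d ∈ divisors m → d ∣ m
  ∈-divisors⁻ m d∈ = proj₂ (∈-filter⁻ (_∣? m) {xs = map suc (upTo m)} d∈)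

  ∈-divisors⁺ : ∀ {m d} .{{_ : NonZero m}} → d ∣ m → d ∈ divisors m
  ∈-divisors⁺ {m} {zero} d∣m with () ← ≢-nonZero⁻¹ m (0∣⇒≡0 d∣m)
  ∈-divisors⁺ {m} {suc d} d∣m = ∈-filter⁺ (_∣? m) (∈-map⁺ suc (∈-upTo⁺ (∣⇒≤ d∣m))) d∣m

  σ[p]≤1+p : ∀ {p} → Prime p → σ p ≤ 1 + p
  σ[p]≤1+p {p} pp = ≤-trans (sum-mono-⊆ (divisors-unique p) divisors⊆[1,p]) (≤-reflexive (cong suc (+-identityʳ p)))
    where
    divisors⊆[1,p] : divisors p ⊆ 1 ∷ p ∷ []
    divisors⊆[1,p] d∈ with prime⇒irreducible pp (∈-divisors⁻ p d∈)
    ... | inj₁ refl = here refl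
    ... | inj₂ refl = there (here refl)

  geometric-sum : ∀ u n → 1 + u * sum (applyDownFrom (suc u ^_) n) ≡ suc u ^ n
  geometric-sum u zero = cong suc (*-zeroʳ u)
  geometric-sum u (suc n) = begin
    suc (u * (x + s))      ≡⟨ cong suc (*-distribˡ-+ u x s) ⟩
    suc (u * x + u * s)    ≡⟨ +-suc (u * x) (u * s) ⟨
    u * x + suc (u * s)    ≡⟨ cong (u * x +_) (geometric-sum u n) ⟩
    u * x + x              ≡⟨ +-comm (u * x) x ⟩
    x + u * x              ∎
    where
    open ≡-Reasoning
    x = suc u ^ n
    s = sum (applyDownFrom (suc u ^_) n)

  prime∤⇒coprime : ∀ {p n} → Prime p → ¬ p ∣ n → Coprime p n
  prime∤⇒coprime pp p∤n (i∣p , i∣n) with prime⇒irreducible pp i∣p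
  ... | inj₁ i≡1 = i≡1
  ... | inj₂ refl = contradiction i∣n p∤n

  ∣p^a⇒≡p^i : ∀ {p} → Prime p → ∀ a {d} → d ∣ p ^ a → ∃[ i ] (i ≤ a × d ≡ p ^ i)
  ∣p^a⇒≡p^i pp zero d∣1 = 0 , z≤n , ∣1⇒≡1 d∣1
  ∣p^a⇒≡p^i {p} pp (suc a) {d} d∣p^1+a with p ∣? d
  ... | no p∤d
    with i , i≤a , refl ← ∣p^a⇒≡p^i pp a (coprime-divisor (coprime-sym (prime∤⇒coprime pp p∤d)) d∣p^1+a)
    = i , m≤n⇒m≤1+n i≤a , refl
  ... | yes (divides e refl)
    with i , i≤a , refl ← ∣p^a⇒≡p^i pp a (*-cancelˡ-∣ p {{prime⇒nonZero pp}} (subst (_∣ p * p ^ a) (*-comm e p) d∣p^1+a))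
    = suc i , s≤s i≤a , *-comm (p ^ i) p

  [p∸1]*σ[p^a]<p^[1+a] : ∀ {p} → Prime p → ∀ a → (p ∸ 1) * σ (p ^ a) < p ^ suc a
  [p∸1]*σ[p^a]<p^[1+a] {suc u} pp a = begin-strict
    u * σ (suc u ^ a)                            <⟨ s≤s (*-monoʳ-≤ u (sum-mono-⊆ (divisors-unique (suc u ^ a)) divisors⊆powers)) ⟩
    1 + u * sum (applyDownFrom (suc u ^_) (suc a)) ≡⟨ geometric-sum u (suc a) ⟩
    suc u ^ suc a                                ∎
    where
    open ≤-Reasoning
    divisors⊆powers : divisors (suc u ^ a) ⊆ applyDownFrom (suc u ^_) (suc a)
    divisors⊆powers d∈ with i , i≤a , refl ← ∣p^a⇒≡p^i pp a (∈-divisors⁻ (suc u ^ a) d∈) = ∈-applyDownFrom⁺ (suc u ^_) (s≤s i≤a)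

  ∣m*n⇒≡g*e : ∀ {d} m n .{{_ : NonZero m}} → d ∣ m * n → ∃[ g ] ∃[ e ] (g ∣ m × e ∣ n × d ≡ g * e)
  ∣m*n⇒≡g*e {d} m n d∣mn = g , d / g , gcd[m,n]∣n d m , d/g∣n , sym (m*[n/m]≡n (gcd[m,n]∣m d m))
    where
    g = gcd d m
    instance
      g≢0 : NonZero g
      g≢0 = ≢-nonZero (gcd[m,n]≢0 d m (inj₂ (≢-nonZero⁻¹ m)))
    g[d/g]∣g[m/g]n : g * (d / g) ∣ g * (m / g * n)
    g[d/g]∣g[m/g]n = subst₂ _∣_ (sym (m*[n/m]≡n (gcd[m,n]∣m d m)))
      (trans (cong (_* n) (sym (m*[n/m]≡n (gcd[m,n]∣n d m)))) (*-assoc g (m / g) n)) d∣mn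
    d/g∣n : d / g ∣ n
    d/g∣n = coprime-divisor (coprime-/gcd d m) (*-cancelˡ-∣ g g[d/g]∣g[m/g]n)

  σ-submultiplicative : ∀ m n → σ (m * n) ≤ σ m * σ n
  σ-submultiplicative zero n = z≤n
  σ-submultiplicative (suc m) zero rewrite *-zeroʳ m = z≤n
  σ-submultiplicative m@(suc _) n@(suc _) = begin
    σ (m * n)                                                ≤⟨ sum-mono-⊆ (divisors-unique (m * n)) divisors⊆products ⟩
    sum (cartesianProductWith _*_ (divisors m) (divisors n)) ≡⟨ sum-cartesianProductWith-* (divisors m) (divisors n) ⟩
    σ m * σ n                                                ∎
    where
    open ≤-Reasoning
    divisors⊆products : divisors (m * n) ⊆ cartesianProductWith _*_ (divisors m) (divisors n)
    divisors⊆products d∈ with g , e , g∣m , e∣n , refl ← ∣m*n⇒≡g*e m n (∈-divisors⁻ (m * n) d∈)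
      = ∈-cartesianProductWith⁺ _*_ (∈-divisors⁺ g∣m) (∈-divisors⁺ e∣n)

  coprime-∣ : ∀ {m n d e} → Coprime m n → d ∣ m → e ∣ n → Coprime d e
  coprime-∣ m⊥n d∣m e∣n (i∣d , i∣e) = m⊥n (∣-trans i∣d d∣m , ∣-trans i∣e e∣n)

  *-injective-coprime : ∀ {m n w x y z} → Coprime m n → w ∣ m → x ∣ m → y ∣ n → z ∣ n →
                        w * y ≡ x * z → w ≡ x × y ≡ z
  *-injective-coprime {w = w} {x} {y} {z} m⊥n w∣m x∣m y∣n z∣n wy≡xz =
    ∣-antisym (∣-of-product (coprime-∣ m⊥n w∣m z∣n) wy≡xz) (∣-of-product (coprime-∣ m⊥n x∣m y∣n) (sym wy≡xz)) ,
    ∣-antisym (∣-of-product (coprime-∣ (coprime-sym m⊥n) y∣n x∣m) yw≡zx)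
              (∣-of-product (coprime-∣ (coprime-sym m⊥n) z∣n w∣m) (sym yw≡zx))
    where
    ∣-of-product : ∀ {a b c d} → Coprime a d → a * b ≡ c * d → a ∣ c
    ∣-of-product {a} {b} {c} {d} a⊥d ab≡cd = coprime-divisor a⊥d (divides b (trans (*-comm d c) (trans (sym ab≡cd) (*-comm a b))))
    yw≡zx : y * w ≡ z * x
    yw≡zx = trans (*-comm y w) (trans wy≡xz (*-comm x z))

  σ-multiplicative : ∀ {m n} .{{_ : NonZero m}} .{{_ : NonZero n}} → Coprime m n → σ (m * n) ≡ σ m * σ n
  σ-multiplicative {m} {n} m⊥n = ≤-antisym (σ-submultiplicative m n) (begin
    σ m * σ n                                                ≡⟨ sum-cartesianProductWith-* (divisors m) (divisors n) ⟨
    sum (cartesianProductWith _*_ (divisors m) (divisors n)) ≤⟨ sum-mono-⊆ products-unique products⊆divisors ⟩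
    σ (m * n)                                                ∎)
    where
    open ≤-Reasoning
    instance
      mn≢0 : NonZero (m * n)
      mn≢0 = m*n≢0 m n
    products-unique : Unique (cartesianProductWith _*_ (divisors m) (divisors n))
    products-unique = cartesianProductWith⁺-injectiveOn _*_
      (λ w∈ x∈ y∈ z∈ → *-injective-coprime m⊥n (∈-divisors⁻ m w∈) (∈-divisors⁻ m x∈) (∈-divisors⁻ n y∈) (∈-divisors⁻ n z∈))
      (divisors-unique m) (divisors-unique n)
    products⊆divisors : cartesianProductWith _*_ (divisors m) (divisors n) ⊆ divisors (m * n)
    products⊆divisors v∈ with g , e , g∈ , e∈ , refl ← ∈-cartesianProductWith⁻ _*_ (divisors m) (divisors n) v∈
      = ∈-divisors⁺ (*-pres-∣ (∈-divisors⁻ m g∈) (∈-divisors⁻ n e∈))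

  σ∘σ-submultiplicative-coprime : ∀ {m n} .{{_ : NonZero m}} .{{_ : NonZero n}} → Coprime m n →
                                  σ (σ (m * n)) ≤ σ (σ m) * σ (σ n)
  σ∘σ-submultiplicative-coprime {m} {n} m⊥n = begin
    σ (σ (m * n))      ≡⟨ cong σ (σ-multiplicative m⊥n) ⟩
    σ (σ m * σ n)      ≤⟨ σ-submultiplicative (σ m) (σ n) ⟩
    σ (σ m) * σ (σ n)  ∎
    where open ≤-Reasoning

  prime∤⇒coprime-^ : ∀ {p n} → Prime p → ¬ p ∣ n → ∀ a → Coprime (p ^ a) n
  prime∤⇒coprime-^ {p} pp p∤n a (i∣p^a , i∣n) with ∣p^a⇒≡p^i pp a i∣p^a
  ... | zero , _ , refl = refl
  ... | suc j , _ , refl = contradiction (∣-trans (m∣m*n (p ^ j)) i∣n) p∤n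

  prime∣p^a⇒≡ : ∀ {p q} → Prime p → Prime q → ∀ a → q ∣ p ^ a → q ≡ p
  prime∣p^a⇒≡ {p} pp qp a q∣p^a with ∣p^a⇒≡p^i pp a q∣p^a
  ... | zero , _ , refl = contradiction qp ¬prime[1]
  ... | suc j , _ , refl with prime⇒irreducible qp (m∣m*n {p} (p ^ j))
  ...   | inj₁ refl = contradiction pp ¬prime[1]
  ...   | inj₂ p≡q = sym p≡q

  coprime⇒∤ : ∀ {m n q} → Coprime m n → Prime q → q ∣ n → ¬ q ∣ m
  coprime⇒∤ m⊥n qp q∣n q∣m = ¬prime[1] (subst Prime (m⊥n (q∣m , q∣n)) qp)

  ^-monoʳ-∣ : ∀ p {i j} → i ≤ j → p ^ i ∣ p ^ j
  ^-monoʳ-∣ p {j = j} z≤n = 1∣ (p ^ j)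
  ^-monoʳ-∣ p (s≤s i≤j) = *-monoʳ-∣ p (^-monoʳ-∣ p i≤j)

  ∥⇒≤ : ∀ {p a n} k → p ^ a ∥ n → p ^ k ∣ n → k ≤ a
  ∥⇒≤ {p} {a} k (_ , p^1+a∤n) p^k∣n with k ≤? a
  ... | yes k≤a = k≤a
  ... | no k≰a = contradiction (∣-trans (^-monoʳ-∣ p (≰⇒> k≰a)) p^k∣n) p^1+a∤n

  p^a∥p^a*m : ∀ {p m} → Prime p → ¬ p ∣ m → ∀ a → p ^ a ∥ (p ^ a * m)
  p^a∥p^a*m {p} {m} pp p∤m a = m∣m*n m , p∤m ∘ *-cancelˡ-∣ (p ^ a) ∘ subst (_∣ p ^ a * m) (*-comm p (p ^ a))
    where instance _ = prime⇒nonZero pp ; _ = m^n≢0 p a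

  ∥-*ˡ : ∀ {q b m} d → Coprime (q ^ suc b) d → q ^ b ∥ m → q ^ b ∥ (d * m)
  ∥-*ˡ d q^1+b⊥d (q^b∣m , q^1+b∤m) = ∣n⇒∣m*n d q^b∣m , q^1+b∤m ∘ coprime-divisor q^1+b⊥d

  KalitaSaikia-coprime-factor : ∀ {d m} → Coprime d m → KalitaSaikia (d * m) → KalitaSaikia m
  KalitaSaikia-coprime-factor {d} {m} d⊥m (dm>0 , σ[q^b]-prime) = m>0 , σ[q^b∥m]-prime
    where
    m>0 : 0 < m
    m>0 = >-nonZero⁻¹ m {{m*n≢0⇒n≢0 d {{>-nonZero dm>0}}}}
    σ[q^b∥m]-prime : ∀ q b → Prime q → 1 ≤ b → q ^ b ∥ m → Prime (σ (q ^ b))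
    σ[q^b∥m]-prime q b@(suc b′) qp b≥1 q^b∥m@(q^b∣m , _) = σ[q^b]-prime q b qp b≥1 (∥-*ˡ {q} {b} d q^1+b⊥d q^b∥m)
      where q^1+b⊥d = prime∤⇒coprime-^ qp (coprime⇒∤ d⊥m qp (∣-trans (m∣m*n (q ^ b′)) q^b∣m)) (suc b)

  FourFull : ℕ → Set
  FourFull n = ∀ p → Prime p → p ∣ n → p ^ 4 ∣ n

  FourFull-coprime-factor : ∀ {d m} → Coprime d m → FourFull (d * m) → FourFull m
  FourFull-coprime-factor {d} d⊥m d*m-full q qp q∣m =
    coprime-divisor (prime∤⇒coprime-^ qp (coprime⇒∤ d⊥m qp q∣m) 4) (d*m-full q qp (∣n⇒∣m*n d q∣m))

  primeDivisors-unique : ∀ n → Unique (primeDivisors n)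
  primeDivisors-unique n = Unique.filter⁺ prime? (divisors-unique n)

  ∈-primeDivisors⁻ : ∀ n {q} → q ∈ primeDivisors n → Prime q × q ∣ n
  ∈-primeDivisors⁻ n q∈ with q∈divisors , qp ← ∈-filter⁻ prime? {xs = divisors n} q∈ = qp , ∈-divisors⁻ n q∈divisors

  ∈-primeDivisors⁺ : ∀ {n q} .{{_ : NonZero n}} → Prime q → q ∣ n → q ∈ primeDivisors n
  ∈-primeDivisors⁺ qp q∣n = ∈-filter⁺ prime? (∈-divisors⁺ q∣n) qp

  primeDivisors-p^a*m : ∀ {p m} .{{_ : NonZero m}} → Prime p → ¬ p ∣ m → ∀ a → .{{NonZero a}} →
                        primeDivisors (p ^ a * m) ↭ p ∷ primeDivisors m
  primeDivisors-p^a*m {p} {m} pp p∤m a@(suc a′) = ∼bag⇒↭ (unique∧set⇒bag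
    (primeDivisors-unique (p ^ a * m))
    (All.tabulate p≢ ∷ primeDivisors-unique m)
    (mk⇔ to from))
    where
    instance _ = m*n≢0 (p ^ a) m {{m^n≢0 p a {{prime⇒nonZero pp}}}}
    p≢ : ∀ {q} → q ∈ primeDivisors m → p ≢ q
    p≢ q∈ refl = p∤m (proj₂ (∈-primeDivisors⁻ m q∈))
    to : ∀ {q} → q ∈ primeDivisors (p ^ a * m) → q ∈ p ∷ primeDivisors m
    to q∈ with qp , q∣p^a*m ← ∈-primeDivisors⁻ (p ^ a * m) q∈ with euclidsLemma (p ^ a) m qp q∣p^a*m
    ... | inj₁ q∣p^a = here (prime∣p^a⇒≡ pp qp a q∣p^a)
    ... | inj₂ q∣m = there (∈-primeDivisors⁺ qp q∣m)
    from : ∀ {q} → q ∈ p ∷ primeDivisors m → q ∈ primeDivisors (p ^ a * m)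
    from (here refl) = ∈-primeDivisors⁺ pp (∣-trans (m∣m*n (p ^ a′)) (m∣m*n m))
    from (there q∈) with qp , q∣m ← ∈-primeDivisors⁻ m q∈ = ∈-primeDivisors⁺ qp (∣n⇒∣m*n (p ^ a) q∣m)

  ∃-prime-divisor : ∀ {n} → 1 < n → ∃[ p ] (Prime p × p ∣ n)
  ∃-prime-divisor {n@(suc _)} 1<n with factorise n
  ... | record { factors = [] ; isFactorisation = refl } = contradiction 1<n (<-irrefl refl)
  ... | record { factors = p ∷ ps ; isFactorisation = n≡p*Πps ; factorsPrime = pp ∷ _ } =
    p , pp , divides (product ps) (trans n≡p*Πps (*-comm p (product ps)))

  split-power : ∀ {p} → 1 < p → ∀ n → .{{NonZero n}} → ∃[ a ] ∃[ m ] (¬ p ∣ m × n ≡ p ^ a * m)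
  split-power {p} 1<p = <-rec _ split
    where
    split : ∀ n → (∀ {k} → k < n → .{{NonZero k}} → ∃[ a ] ∃[ m ] (¬ p ∣ m × k ≡ p ^ a * m)) →
            .{{NonZero n}} → ∃[ a ] ∃[ m ] (¬ p ∣ m × n ≡ p ^ a * m)
    split n rec with p ∣? n
    ... | no p∤n = 0 , n , p∤n , sym (+-identityʳ n)
    ... | yes (divides k refl) = let instance _ = m*n≢0⇒m≢0 k in *p (rec (m<m*n k p 1<p))
      where
      *p : ∃[ a ] ∃[ m ] (¬ p ∣ m × k ≡ p ^ a * m) → ∃[ a ] ∃[ m ] (¬ p ∣ m × k * p ≡ p ^ a * m)
      *p (a , m , p∤m , refl) = suc a , m , p∤m , trans (*-comm (p ^ a * m) p) (sym (*-assoc p (p ^ a) m))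

  prime>1 : ∀ {p} → Prime p → 1 < p
  prime>1 {p} pp = nonTrivial⇒n>1 p {{prime⇒nonTrivial pp}}

  prime-power-split : ∀ {n} → 1 < n → ∃[ p ] ∃[ a ] ∃[ m ] (Prime p × ¬ p ∣ m × n ≡ p ^ suc a * m)
  prime-power-split {n} 1<n with p , pp , p∣n ← ∃-prime-divisor 1<n with split-power (prime>1 pp) n {{>-nonZero (<⇒≤ 1<n)}}
  ... | zero , m , p∤m , n≡1*m = contradiction (subst (p ∣_) (trans n≡1*m (*-identityˡ m)) p∣n) p∤m
  ... | suc a , m , p∤m , n≡p^[1+a]*m = p , a , m , pp , p∤m , n≡p^[1+a]*m

  m<p^[1+a]*m : ∀ {p m} a .{{_ : NonZero m}} → 1 < p → m < p ^ suc a * m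
  m<p^[1+a]*m {p} {m} a 1<p = subst (m <_) (*-comm m (p ^ suc a)) (m<m*n m (p ^ suc a) (^-monoʳ-< p 1<p {0} {suc a} z<s))

module Fractions where
  open import Data.Nat
  open import Data.Nat.Properties
  open import Data.Nat.Tactic.RingSolver using (solve-∀)
  open import Data.Integer using (+_; +≤+) renaming (_+_ to _+ℤ_; _≤_ to _≤ℤ_)
  open import Data.Integer.Properties using (pos-+; pos-*)
  open import Data.Rational using (ℚ; NonNegative; toℚᵘ) renaming (_≤_ to _≤ℚ_; _*_ to _*ℚ_; _+_ to _+ℚ_)
  import Data.Rational.Properties as ℚ
  open import Data.Rational.Unnormalised using (ℚᵘ; mkℚᵘ; *≤*) renaming (_≤_ to _≤ᵘ_; _≃_ to _≃ᵘ_; _*_ to _*ᵘ_; _+_ to _+ᵘ_)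
  import Data.Rational.Unnormalised.Properties as ℚᵘ
  open import Data.List.Relation.Binary.Permutation.Propositional using (_↭_; ↭⇒↭ₛ)
  open import Data.List.Relation.Binary.Permutation.Setoid.Properties using (foldr-commMonoid)
  open import Relation.Binary.PropositionalEquality

  fracᵘ : ℕ → ℕ → ℚᵘ
  fracᵘ a b = mkℚᵘ (+ a) (pred b)

  toℚᵘ-frac : ∀ a b .{{_ : NonZero b}} → toℚᵘ (frac a b) ≃ᵘ fracᵘ a b
  toℚᵘ-frac a (suc b) = ℚ.toℚᵘ-fromℚᵘ (mkℚᵘ (+ a) b)

  fracᵘ-≤ : ∀ {a b c d} .{{_ : NonZero b}} .{{_ : NonZero d}} → a * d ≤ c * b → fracᵘ a b ≤ᵘ fracᵘ c d
  fracᵘ-≤ {a} {suc b} {c} {suc d} ad≤cb = *≤* (subst₂ _≤ℤ_ (pos-* a (suc d)) (pos-* c (suc b)) (+≤+ ad≤cb))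

  fracᵘ-* : ∀ a b c d .{{_ : NonZero b}} .{{_ : NonZero d}} → fracᵘ a b *ᵘ fracᵘ c d ≃ᵘ fracᵘ (a * c) (b * d)
  fracᵘ-* a (suc b) c (suc d) = ℚᵘ.≃-reflexive (cong (λ n → mkℚᵘ n (pred (suc b * suc d))) (sym (pos-* a c)))

  fracᵘ-+ : ∀ a b c d .{{_ : NonZero b}} .{{_ : NonZero d}} →
            fracᵘ a b +ᵘ fracᵘ c d ≃ᵘ fracᵘ (a * d + c * b) (b * d)
  fracᵘ-+ a (suc b) c (suc d) = ℚᵘ.≃-reflexive (cong (λ n → mkℚᵘ n (pred (suc b * suc d)))
    (sym (trans (pos-+ (a * suc d) (c * suc b)) (cong₂ _+ℤ_ (pos-* a (suc d)) (pos-* c (suc b))))))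

  frac-≤ : ∀ {a b c d} .{{_ : NonZero b}} .{{_ : NonZero d}} → a * d ≤ c * b → frac a b ≤ℚ frac c d
  frac-≤ {a} {b} {c} {d} ad≤cb = ℚ.toℚᵘ-cancel-≤
    (ℚᵘ.≤-respʳ-≃ (ℚᵘ.≃-sym (toℚᵘ-frac c d)) (ℚᵘ.≤-respˡ-≃ (ℚᵘ.≃-sym (toℚᵘ-frac a b)) (fracᵘ-≤ ad≤cb)))

  frac-monoˡ-≤ : ∀ {a c} b .{{_ : NonZero b}} → a ≤ c → frac a b ≤ℚ frac c b
  frac-monoˡ-≤ b a≤c = frac-≤ (*-monoˡ-≤ b a≤c)

  frac-* : ∀ a b c d .{{_ : NonZero b}} .{{_ : NonZero d}} → frac a b *ℚ frac c d ≡ frac (a * c) (b * d)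
  frac-* a b c d = ℚ.toℚᵘ-injective (begin
    toℚᵘ (frac a b *ℚ frac c d)            ≈⟨ ℚ.toℚᵘ-homo-* (frac a b) (frac c d) ⟩
    toℚᵘ (frac a b) *ᵘ toℚᵘ (frac c d)     ≈⟨ ℚᵘ.*-cong (toℚᵘ-frac a b) (toℚᵘ-frac c d) ⟩
    fracᵘ a b *ᵘ fracᵘ c d                 ≈⟨ fracᵘ-* a b c d ⟩
    fracᵘ (a * c) (b * d)                  ≈⟨ toℚᵘ-frac (a * c) (b * d) ⟨
    toℚᵘ (frac (a * c) (b * d))            ∎)
    where
    open ℚᵘ.≃-Reasoning
    instance _ = m*n≢0 b d

  frac-+ : ∀ a b c d .{{_ : NonZero b}} .{{_ : NonZero d}} → frac a b +ℚ frac c d ≡ frac (a * d + c * b) (b * d)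
  frac-+ a b c d = ℚ.toℚᵘ-injective (begin
    toℚᵘ (frac a b +ℚ frac c d)            ≈⟨ ℚ.toℚᵘ-homo-+ (frac a b) (frac c d) ⟩
    toℚᵘ (frac a b) +ᵘ toℚᵘ (frac c d)     ≈⟨ ℚᵘ.+-cong (toℚᵘ-frac a b) (toℚᵘ-frac c d) ⟩
    fracᵘ a b +ᵘ fracᵘ c d                 ≈⟨ fracᵘ-+ a b c d ⟩
    fracᵘ (a * d + c * b) (b * d)          ≈⟨ toℚᵘ-frac (a * d + c * b) (b * d) ⟨
    toℚᵘ (frac (a * d + c * b) (b * d))    ∎)
    where
    open ℚᵘ.≃-Reasoning
    instance _ = m*n≢0 b d

  frac-nonNeg : ∀ a b → NonNegative (frac a b)
  frac-nonNeg a zero = _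
  frac-nonNeg a (suc b) = ℚ.normalize-nonNeg a (suc b)

  factor-nonNeg : ∀ p → NonNegative (factor p)
  factor-nonNeg p = ℚ.nonNeg+nonNeg⇒nonNeg (frac p (p ∸ 1)) {{frac-nonNeg p (p ∸ 1)}} (frac 1 (p ^ 4)) {{frac-nonNeg 1 (p ^ 4)}}

  -- (1 + s) / P ≤ (1 + u) / u + 1 / Q, cross-multiplied in the shape that frac-+ produces
  cross-multiplied-factor-bound : ∀ {u s P Q} → Q ≤ P → u * s < suc u * P →
                                  (1 + s) * (u * Q) ≤ (suc u * Q + 1 * u) * P
  cross-multiplied-factor-bound {u} {s} {P} {Q} Q≤P us<[1+u]P = begin
    (1 + s) * (u * Q)          ≡⟨ expand s u Q ⟩
    u * Q + u * s * Q          ≤⟨ +-monoʳ-≤ (u * Q) (*-monoˡ-≤ Q (n≤1+n (u * s))) ⟩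
    u * Q + suc (u * s) * Q    ≤⟨ +-mono-≤ (*-monoʳ-≤ u Q≤P) (*-monoˡ-≤ Q us<[1+u]P) ⟩
    u * P + suc u * P * Q      ≡⟨ collect u P Q ⟩
    (suc u * Q + 1 * u) * P    ∎
    where
    open ≤-Reasoning
    expand : ∀ s u Q → (1 + s) * (u * Q) ≡ u * Q + u * s * Q
    expand = solve-∀
    collect : ∀ u P Q → u * P + suc u * P * Q ≡ (suc u * Q + 1 * u) * P
    collect = solve-∀

  frac-≤-factor : ∀ {p s} a → 1 < p → 4 ≤ a → (p ∸ 1) * s < p ^ suc a → frac (1 + s) (p ^ a) ≤ℚ factor p
  frac-≤-factor {p@(suc u)} {s} a (s≤s 1≤u) 4≤a us<p^1+a = begin
    frac (1 + s) (p ^ a)                  ≤⟨ frac-≤ (cross-multiplied-factor-bound (^-monoʳ-≤ p 4≤a) us<p^1+a) ⟩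
    frac (p * p ^ 4 + 1 * u) (u * p ^ 4)  ≡⟨ frac-+ p u 1 (p ^ 4) ⟨
    factor p                              ∎
    where
    open ℚ.≤-Reasoning
    instance
      _ = >-nonZero 1≤u
      _ = m^n≢0 p a
      _ = m^n≢0 p 4
      _ = m*n≢0 u (p ^ 4)

  prodℚ-↭ : ∀ {xs ys} → xs ↭ ys → prodℚ xs ≡ prodℚ ys
  prodℚ-↭ xs↭ys = foldr-commMonoid (setoid ℚ) ℚ.*-1-isCommutativeMonoid (↭⇒↭ₛ xs↭ys)

module RatioBound where
  open Arithmetic
  open Fractions
  open import Data.Nat
  open import Data.Nat.Properties
  open import Data.Nat.Divisibility using (_∣_; m∣m*n; ∣-trans)
  open import Data.Nat.Primality using (Prime; prime⇒nonZero)
  open import Data.List using (_∷_; map)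
  open import Data.List.Relation.Binary.Permutation.Propositional.Properties using (map⁺)
  open import Data.Rational using () renaming (_≤_ to _≤ℚ_; _*_ to _*ℚ_)
  import Data.Rational.Properties as ℚ
  open import Relation.Nullary using (¬_)
  open import Data.Product using (_,_; proj₁)
  open import Relation.Binary.PropositionalEquality using (refl)

  RatioBounded : ℕ → Set
  RatioBounded n = frac (σ (σ n)) n ≤ℚ prodℚ (map factor (primeDivisors n))

  ratioBounded-p^a*m : ∀ {p m} .{{_ : NonZero m}} → Prime p → ¬ p ∣ m → ∀ a .{{_ : NonZero a}} →
                       KalitaSaikia (p ^ a * m) → FourFull (p ^ a * m) → RatioBounded m → RatioBounded (p ^ a * m)
  ratioBounded-p^a*m {p} {m} pp p∤m a@(suc a′) (_ , σ[q^b∥n]-prime) full m-bounded = begin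
    frac (σ (σ (P * m))) (P * m)                 ≤⟨ frac-monoˡ-≤ (P * m) (σ∘σ-submultiplicative-coprime P⊥m) ⟩
    frac (σ (σ P) * σ (σ m)) (P * m)             ≡⟨ frac-* (σ (σ P)) P (σ (σ m)) m ⟨
    frac (σ (σ P)) P *ℚ frac (σ (σ m)) m         ≤⟨ ℚ.*-monoʳ-≤-nonNeg (frac (σ (σ m)) m) {{frac-nonNeg (σ (σ m)) m}} σ[σ[P]]/P≤factor ⟩
    factor p *ℚ frac (σ (σ m)) m                 ≤⟨ ℚ.*-monoˡ-≤-nonNeg (factor p) {{factor-nonNeg p}} m-bounded ⟩
    prodℚ (map factor (p ∷ primeDivisors m))     ≡⟨ prodℚ-↭ (map⁺ factor (primeDivisors-p^a*m pp p∤m a)) ⟨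
    prodℚ (map factor (primeDivisors (P * m)))   ∎
    where
    open ℚ.≤-Reasoning
    P = p ^ a
    instance
      _ = prime⇒nonZero pp
      _ = m^n≢0 p a
      _ = m*n≢0 P m
    P⊥m = prime∤⇒coprime-^ pp p∤m a
    P∥n = p^a∥p^a*m pp p∤m a
    σ[P]-prime : Prime (σ P)
    σ[P]-prime = σ[q^b∥n]-prime p a pp (s≤s z≤n) P∥n
    4≤a : 4 ≤ a
    4≤a = ∥⇒≤ {p} 4 P∥n (full p pp (∣-trans (m∣m*n (p ^ a′)) (m∣m*n m)))
    σ[σ[P]]/P≤factor : frac (σ (σ P)) P ≤ℚ factor p
    σ[σ[P]]/P≤factor = ℚ.≤-trans (frac-monoˡ-≤ P (σ[p]≤1+p σ[P]-prime))
      (frac-≤-factor a (prime>1 pp) 4≤a ([p∸1]*σ[p^a]<p^[1+a] pp a))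

  ratioBounded-step : ∀ {n} → 1 < n → (∀ {m} → m < n → KalitaSaikia m → FourFull m → RatioBounded m) →
                      KalitaSaikia n → FourFull n → RatioBounded n
  ratioBounded-step 1<n rec ks full with prime-power-split 1<n
  ... | p , a , m , pp , p∤m , refl =
    ratioBounded-p^a*m pp p∤m (suc a) ks full
      (rec (m<p^[1+a]*m a (prime>1 pp)) (KalitaSaikia-coprime-factor P⊥m ks) (FourFull-coprime-factor P⊥m full))
    where
    instance _ = m*n≢0⇒n≢0 (p ^ suc a) {{>-nonZero (proj₁ ks)}}
    P⊥m = prime∤⇒coprime-^ pp p∤m (suc a)

open import Data.Nat using (ℕ; _^_)
open import Data.Nat.Divisibility using (_∣_)
open import Data.Nat.Primality using (Prime)
open import Data.List using (map)
open import Data.Rational using (_≤_)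
open Arithmetic using (FourFull)
open RatioBound

mainTheorem4 : ∀ (n : ℕ) → KalitaSaikia n → (∀ p → Prime p → p ∣ n → p ^ 4 ∣ n)
    → frac (σ (σ n)) n ≤ prodℚ (map factor (primeDivisors n))
mainTheorem4 = <-rec _ bound
  where
  open import Data.Nat using (suc; _<_; s≤s; z≤n)
  open import Data.Product using (_,_)
  open import Data.Nat.Induction using (<-rec)
  open import Data.Rational.Properties using (≤-refl)
  bound : ∀ n → (∀ {m} → m < n → KalitaSaikia m → FourFull m → RatioBounded m) →
          KalitaSaikia n → FourFull n → RatioBounded n
  bound 0 _ (() , _) _
  bound 1 _ _ _ = ≤-refl
  bound (suc (suc _)) = ratioBounded-step (s≤s (s≤s z≤n))
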